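{- For every object $A$ generated by the grammar $A::=X\mid A\otimes A\mid\,!A$, every occurrence of $X$ in $A$, and every natural number $x$, we have $2\theta_A(x)\le\theta_A(2b^-+2x)$, where $b^-$ is one less than the number of occurrences of $X$ in $A$.
   Context: Let $X$ be a fixed object regarded as atomic, and consider objects generated by $A::=X\mid A\otimes A\mid\,!A$. For an occurrence of $X$ in $A$, define an arithmetic expression $\theta_A(x)$ in a variable $x$ recursively: if $A=X$ then $\theta_X(x)=x$; $\theta_{!A}(x)=2\theta_A(x)$; if the occurrence lies in $A$, then $\theta_{A\otimes A'}(x)=b+\theta_A(x)$ and $\theta_{A'\otimes A}(x)=b+\theta_A(x)$, where $b$ is the number of occurrences of $X$ in $A'$. -}

module Defs where

open import Data.Nat using (ℕ; suc; _+_; _*_; _∸_)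

data Obj : Set where
  X   : Obj
  _⊗_ : Obj → Obj → Obj
  !_  : Obj → Obj

occ : Obj → ℕ
occ X       = 1
occ (A ⊗ B) = occ A + occ B
occ (! A)   = occ A

-- an occurrence of X in A (a path to a leaf X)
data Occ : Obj → Set where
  here  : Occ X
  left  : ∀ {A B} → Occ A → Occ (A ⊗ B)
  right : ∀ {A B} → Occ B → Occ (A ⊗ B)
  bang  : ∀ {A} → Occ A → Occ (! A)

θ : ∀ {A} → Occ A → ℕ → ℕ
θ here x                = x
θ (bang o) x            = 2 * θ o x
θ (left {B = B} o) x    = occ B + θ o x
θ (right {A = A} o) x   = occ A + θ o x

b⁻ : Obj → ℕ
b⁻ A = occ A ∸ 1

module Submission where

-- For a fixed occurrence o of X in A the map x ↦ θ_A(x)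
-- is affine:  θ_A(x) = θ_A(0) + s·x,  where the slope s = 2^(number of !'s
-- above o) is at least 1 (`θ-affine`).  The offset is controlled by the
-- number of occurrences: θ_A(0) + s ≤ s·occ(A) (`offset-bound`), i.e.
-- θ_A(0) ≤ s·b⁻ since occ(A) = b⁻ + 1 (`offset≤slope*b⁻`).  The theorem is
-- then an inequality about affine maps with nonnegative offset c ≤ s·m:
--   2(c + s·x) = c + (c + 2s·x) ≤ c + (2s·m + 2s·x) = c + s·(2m + 2x)
-- (`affine-doubling`), applied with m = b⁻.

open import Defs
open import Data.Nat using (ℕ; suc; _+_; _*_; _≤_; z≤n; s≤s)
open import Data.Nat.Properties
open import Relation.Binary.PropositionalEquality
open import Data.Nat.Tactic.RingSolver using (solve-∀)

slope : ∀ {A} → Occ A → ℕ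
slope here      = 1
slope (bang o)  = 2 * slope o
slope (left o)  = slope o
slope (right o) = slope o

slope-positive : ∀ {A} (o : Occ A) → 1 ≤ slope o
slope-positive here      = s≤s z≤n
slope-positive (bang o)  = ≤-trans (slope-positive o) (m≤m+n (slope o) _)
slope-positive (left o)  = slope-positive o
slope-positive (right o) = slope-positive o

≤-slope* : ∀ {A} (o : Occ A) n → n ≤ slope o * n
≤-slope* o n = subst (_≤ slope o * n) (*-identityˡ n) (*-monoˡ-≤ n (slope-positive o))

θ-affine : ∀ {A} (o : Occ A) x → θ o x ≡ θ o 0 + slope o * x
θ-affine here x = sym (+-identityʳ x)
θ-affine (bang o) x = begin
  2 * θ o x                         ≡⟨ cong (2 *_) (θ-affine o x) ⟩
  2 * (θ o 0 + slope o * x)         ≡⟨ *-distribˡ-+ 2 (θ o 0) (slope o * x) ⟩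
  2 * θ o 0 + 2 * (slope o * x)     ≡⟨ cong (2 * θ o 0 +_) (sym (*-assoc 2 (slope o) x)) ⟩
  2 * θ o 0 + 2 * slope o * x       ∎
  where open ≡-Reasoning
θ-affine (left {B = B} o) x =
  trans (cong (occ B +_) (θ-affine o x)) (sym (+-assoc (occ B) (θ o 0) _))
θ-affine (right {A = A} o) x =
  trans (cong (occ A +_) (θ-affine o x)) (sym (+-assoc (occ A) (θ o 0) _))

-- Adding a factor with n occurrences beside the occurrence adds n to the
-- offset and n to occ, so the bound below survives tensoring (the slope
-- being ≥ 1 absorbs the extra n).
offset-bound-⊗ : ∀ {A} (o : Occ A) n →
                 θ o 0 + slope o ≤ slope o * occ A →
                 n + θ o 0 + slope o ≤ slope o * (n + occ A)
offset-bound-⊗ {A} o n ih = begin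
  n + θ o 0 + slope o               ≡⟨ +-assoc n (θ o 0) (slope o) ⟩
  n + (θ o 0 + slope o)             ≤⟨ +-mono-≤ (≤-slope* o n) ih ⟩
  slope o * n + slope o * occ A     ≡⟨ sym (*-distribˡ-+ (slope o) n (occ A)) ⟩
  slope o * (n + occ A)             ∎
  where open ≤-Reasoning

offset-bound : ∀ {A} (o : Occ A) → θ o 0 + slope o ≤ slope o * occ A
offset-bound here = s≤s z≤n
offset-bound {A = ! A} (bang o) = begin
  2 * θ o 0 + 2 * slope o           ≡⟨ sym (*-distribˡ-+ 2 (θ o 0) (slope o)) ⟩
  2 * (θ o 0 + slope o)             ≤⟨ *-monoʳ-≤ 2 (offset-bound o) ⟩
  2 * (slope o * occ A)             ≡⟨ sym (*-assoc 2 (slope o) (occ A)) ⟩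
  2 * slope o * occ A               ∎
  where open ≤-Reasoning
offset-bound (left {A = A} {B = B} o) =
  subst (occ B + θ o 0 + slope o ≤_) (cong (slope o *_) (+-comm (occ B) (occ A)))
        (offset-bound-⊗ o (occ B) (offset-bound o))
offset-bound (right {A = A} o) = offset-bound-⊗ o (occ A) (offset-bound o)

occ≡suc-b⁻ : ∀ A → occ A ≡ suc (b⁻ A)
occ≡suc-b⁻ X       = refl
occ≡suc-b⁻ (A ⊗ B) rewrite occ≡suc-b⁻ A = refl
occ≡suc-b⁻ (! A)   = occ≡suc-b⁻ A

offset≤slope*b⁻ : ∀ {A} (o : Occ A) → θ o 0 ≤ slope o * b⁻ A
offset≤slope*b⁻ {A} o = +-cancelʳ-≤ (slope o) (θ o 0) (slope o * b⁻ A) (begin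
  θ o 0 + slope o                   ≤⟨ offset-bound o ⟩
  slope o * occ A                   ≡⟨ cong (slope o *_) (occ≡suc-b⁻ A) ⟩
  slope o * suc (b⁻ A)              ≡⟨ *-suc (slope o) (b⁻ A) ⟩
  slope o + slope o * b⁻ A          ≡⟨ +-comm (slope o) _ ⟩
  slope o * b⁻ A + slope o          ∎)
  where open ≤-Reasoning

affine-doubling : ∀ c s m x → c ≤ s * m → 2 * (c + s * x) ≤ c + s * (2 * m + 2 * x)
affine-doubling c s m x c≤sm = begin
  2 * (c + s * x)                   ≡⟨ regroup c s x ⟩
  c + (c + 2 * (s * x))             ≤⟨ +-monoʳ-≤ c (+-monoˡ-≤ (2 * (s * x)) c≤2sm) ⟩
  c + (2 * (s * m) + 2 * (s * x))   ≡⟨ cong (c +_) (factor s m x) ⟩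
  c + s * (2 * m + 2 * x)           ∎
  where
    open ≤-Reasoning
    regroup : ∀ c s x → 2 * (c + s * x) ≡ c + (c + 2 * (s * x))
    regroup = solve-∀
    factor : ∀ s m x → 2 * (s * m) + 2 * (s * x) ≡ s * (2 * m + 2 * x)
    factor = solve-∀
    c≤2sm : c ≤ 2 * (s * m)
    c≤2sm = ≤-trans c≤sm (m≤m+n (s * m) _)

mainTheorem17 : (A : Obj) → (o : Occ A) → (x : ℕ) →
                2 * θ o x ≤ θ o (2 * b⁻ A + 2 * x)
mainTheorem17 A o x = begin
  2 * θ o x                                ≡⟨ cong (2 *_) (θ-affine o x) ⟩
  2 * (θ o 0 + slope o * x)                ≤⟨ affine-doubling (θ o 0) (slope o) (b⁻ A) x
                                                (offset≤slope*b⁻ o) ⟩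
  θ o 0 + slope o * (2 * b⁻ A + 2 * x)     ≡⟨ sym (θ-affine o (2 * b⁻ A + 2 * x)) ⟩
  θ o (2 * b⁻ A + 2 * x)                   ∎
  where open ≤-Reasoning
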